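{- Let $n\geq 3$ and let $G$ be a finite simple graph of order $n$ with diameter $2$ such that $n'(G)>\frac{n-1}{2}$. Then $E_2(G)>W(G)$.
   Context: A vertex of $G$ is universal if its degree is $n(G)-1$; $n'(G)$ denotes the number of universal vertices. $\varepsilon_G(v)=\max_u d_G(v,u)$ is the eccentricity, $E_2(G)=\sum_{uv\in E(G)}\varepsilon_G(u)\varepsilon_G(v)$, and $W(G)=\sum_{\{u,v\}\subseteq V(G)}d_G(u,v)$ is the Wiener index. -}

module Defs where

open import Data.Nat using (ℕ; zero; suc; _+_; _*_; _⊔_; _<_)
open import Data.Bool using (Bool; true; false; _∧_; _∨_; if_then_else_; not)
open import Data.Fin using (Fin; _<?_)
open import Data.Fin.Properties using (_≟_)
open import Data.List using (List; map; filter; length; allFin; foldr; concatMap)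
open import Data.Nat.ListAction using (sum)
open import Data.Bool.ListAction using (any)
open import Relation.Nullary.Decidable using (⌊_⌋)
open import Relation.Binary.PropositionalEquality using (_≡_)
open import Data.Product using (_×_; _,_; proj₁; proj₂)
import Data.Nat
import Data.Fin as Fin
import Data.Bool.Properties

record Graph (n : ℕ) : Set where
  field
    adj   : Fin n → Fin n → Bool
    sym   : ∀ u v → adj u v ≡ adj v u
    irrefl : ∀ v → adj v v ≡ false
open Graph public

module _ {n : ℕ} (G : Graph n) where

  vertices : List (Fin n)
  vertices = allFin n

  reach : ℕ → Fin n → Fin n → Bool
  reach zero    u v = ⌊ u ≟ v ⌋
  reach (suc k) u v = reach k u v ∨ any (λ w → reach k u w ∧ adj G w v) vertices

  private
    search : (ℕ → Bool) → ℕ → ℕ → ℕ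
    search p zero       k = k
    search p (suc fuel) k = if p k then k else search p fuel (suc k)

  -- distance d_G(u,v): least k with a walk of length k (searching k = 0..n);
  -- for unreachable pairs (not relevant for connected graphs) it returns n+1.
  dist : Fin n → Fin n → ℕ
  dist u v = search (λ k → reach k u v) (suc n) 0

  degree : Fin n → ℕ
  degree v = length (filter (λ w → adj G v w ≟b true) vertices)
    where
    open import Data.Bool.Properties renaming (_≟_ to _≟b_)

  isUniversal : Fin n → Bool
  isUniversal v = ⌊ degree v Data.Nat.≟ (n Data.Nat.∸ 1) ⌋

  numUniversal : ℕ
  numUniversal = length (filter (λ v → isUniversal v Data.Bool.Properties.≟ true) vertices)

  ecc : Fin n → ℕ
  ecc v = foldr (λ u m → dist v u ⊔ m) 0 vertices

  diameter : ℕ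
  diameter = foldr (λ v m → ecc v ⊔ m) 0 vertices

  pairs : List (Fin n × Fin n)
  pairs = concatMap (λ u → map (λ v → (u , v)) (filter (λ v → u <? v) vertices)) vertices

  E2 : ℕ
  E2 = sum (map (λ p → if adj G (proj₁ p) (proj₂ p) then ecc (proj₁ p) * ecc (proj₂ p) else 0) pairs)

  wiener : ℕ
  wiener = sum (map (λ p → dist (proj₁ p) (proj₂ p)) pairs)

private
  open import Relation.Binary.PropositionalEquality using (refl)
  K3 : Graph 3
  K3 = record { adj = λ u v → Data.Bool.not ⌊ u ≟ v ⌋ ; sym = s ; irrefl = i }
    where
    s : ∀ u v → _ ≡ _
    s Fin.zero Fin.zero = refl
    s Fin.zero (Fin.suc Fin.zero) = refl
    s Fin.zero (Fin.suc (Fin.suc Fin.zero)) = refl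
    s (Fin.suc Fin.zero) Fin.zero = refl
    s (Fin.suc Fin.zero) (Fin.suc Fin.zero) = refl
    s (Fin.suc Fin.zero) (Fin.suc (Fin.suc Fin.zero)) = refl
    s (Fin.suc (Fin.suc Fin.zero)) Fin.zero = refl
    s (Fin.suc (Fin.suc Fin.zero)) (Fin.suc Fin.zero) = refl
    s (Fin.suc (Fin.suc Fin.zero)) (Fin.suc (Fin.suc Fin.zero)) = refl
    i : ∀ v → _ ≡ false
    i Fin.zero = refl
    i (Fin.suc Fin.zero) = refl
    i (Fin.suc (Fin.suc Fin.zero)) = refl
  t1 : diameter K3 ≡ 1
  t1 = refl
  t2 : E2 K3 ≡ 3
  t2 = refl
  t3 : wiener K3 ≡ 3
  t3 = refl
  t4 : numUniversal K3 ≡ 3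
  t4 = refl

-- Since more than half of the vertices are universal, there is a universal vertex w. Hence two
-- distinct non-adjacent vertices are both non-universal and at distance 2 (through w), a vertex
-- with a neighbour has eccentricity at least 1, and a non-universal one has eccentricity at least 2.
-- Comparing the contributions of a pair {u, v} to E₂ and to W then gives
-- ε(u)ε(v)[uv ∈ E] − d(u, v) ≥ [exactly one of u, v universal] − 2 [neither is universal].
-- Summing over pairs, with k universal and r non-universal vertices,
-- E₂ − W ≥ k r − r (r − 1) ≥ r, and r ≥ 1 because the diameter is 2.
module Submission where

open import Defs hiding (sym)
open import Data.Bool using (Bool; true; false; not; _∧_; _∨_; if_then_else_)
open import Data.Bool.ListAction using (any)
open import Data.Bool.Properties using (∨-zeroʳ; ¬-not)
import Data.Bool.Properties as Bool
open import Data.Fin as Fin using (Fin; zero; suc; _<?_)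
open import Data.Fin.Properties using (_≟_; <-cmp; <-asym; <-irrefl; <⇒≢; toℕ<n; ¬∀⟶∃¬)
open import Data.List using (List; []; _∷_; _++_; map; filter; length; foldr; allFin; tabulate; concatMap)
open import Data.List.Membership.Propositional using (_∈_)
open import Data.List.Membership.Propositional.Properties using (∈-allFin)
open import Data.List.Properties using (map-tabulate; map-++; map-∘)
open import Data.List.Relation.Unary.Any using (here; there)
open import Data.Nat as ℕ using (ℕ; zero; suc; _+_; _*_; _∸_; _⊔_; _≤_; _<_; z≤n; s≤s)
open import Data.Nat.ListAction using (sum)
open import Data.Nat.ListAction.Properties using (sum-++)
open import Data.Nat.Properties
  using ( +-*-semiring; module ≤-Reasoning; ≤-refl; ≤-reflexive; ≤-trans; <-≤-trans
        ; 1+n≰n; ≮⇒≥; <⇒≱; suc-injective; +-assoc; +-comm; +-identityʳ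
        ; +-mono-≤; +-monoʳ-≤; +-mono-<; +-cancelˡ-≤; +-cancelʳ-≤; m≤m+n; m≤n+m; m≤n⇒m≤o+n
        ; m<m+n; m+n∸n≡m; m∸n+n≡m; m≤n+m∸n; *-mono-≤; *-monoˡ-≤; *-monoʳ-≤; m≤m⊔n; m≤n⊔m; ⊔-lub )
open import Data.Product using (∃; _×_; _,_; proj₁; proj₂; map₂)
open import Function using (_∘_; id)
open import Relation.Binary.Definitions using (tri<; tri≈; tri>)
open import Relation.Binary.PropositionalEquality
open import Relation.Nullary using (Dec; does; yes; no; ¬_; contradiction)
open import Relation.Nullary.Decidable using (⌊_⌋; isYes≗does; dec-true; dec-false; ¬?; _→-dec_)
open import Relation.Unary using (Pred; Decidable)
open import Algebra.Properties.Semiring.Sum +-*-semiring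
  using ( sum-syntax; ∑-comm; ∑-distrib-+; *-distribˡ-sum; *-distribʳ-sum
        ; sum-cong-≗; sum-replicate-zero )

χ : Bool → ℕ
χ true  = 1
χ false = 0

∑-mono-≤ : ∀ {n} {f g : Fin n → ℕ} → (∀ i → f i ≤ g i) → ∑[ i < n ] f i ≤ ∑[ i < n ] g i
∑-mono-≤ {zero}  f≤g = z≤n
∑-mono-≤ {suc n} f≤g = +-mono-≤ (f≤g zero) (∑-mono-≤ (f≤g ∘ suc))

term≤∑ : ∀ {n} (f : Fin n → ℕ) i → f i ≤ ∑[ j < n ] f j
term≤∑ f zero    = m≤m+n _ _
term≤∑ f (suc i) = m≤n⇒m≤o+n (f zero) (term≤∑ (f ∘ suc) i)

∑-pos⇒∃ : ∀ {n} (f : Fin n → ℕ) → 0 < ∑[ i < n ] f i → ∃ λ i → 0 < f i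
∑-pos⇒∃ {suc n} f ∑>0 with f zero in f₀
... | suc _ = zero , subst (0 <_) (sym f₀) (s≤s z≤n)
... | zero with i , fᵢ>0 ← ∑-pos⇒∃ (f ∘ suc) ∑>0 = suc i , fᵢ>0

∑-const-1 : ∀ n → ∑[ i < n ] 1 ≡ n
∑-const-1 zero    = refl
∑-const-1 (suc n) = cong suc (∑-const-1 n)

∑≡n⇒all-1 : ∀ {n} (f : Fin n → ℕ) → (∀ i → f i ≤ 1) → ∑[ i < n ] f i ≡ n → ∀ i → f i ≡ 1
∑≡n⇒all-1 {suc n} f f≤1 ∑≡n i
  with f zero in f₀ | f≤1 zero | ∑-mono-≤ {f = f ∘ suc} {g = λ _ → 1} (f≤1 ∘ suc)
... | 0 | _ | ∑tail≤∑1 = contradiction (subst₂ _≤_ ∑≡n (∑-const-1 n) ∑tail≤∑1) 1+n≰n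
... | suc (suc _) | s≤s () | _
... | 1 | _ | _ with i
...   | zero  = f₀
...   | suc j = ∑≡n⇒all-1 (f ∘ suc) (f≤1 ∘ suc) (suc-injective ∑≡n) j

∑-δ : ∀ {n} (i : Fin n) x → ∑[ j < n ] (if does (i ≟ j) then x else 0) ≡ x
∑-δ {suc n} zero x = trans (cong (x +_) (sum-replicate-zero n)) (+-identityʳ x)
∑-δ (suc i) x = ∑-δ i x

∑∑-product : ∀ {n} (f g : Fin n → ℕ) →
  ∑[ u < n ] ∑[ v < n ] (f u * g v) ≡ ∑[ u < n ] f u * ∑[ v < n ] g v
∑∑-product {n} f g = begin
  ∑[ u < n ] ∑[ v < n ] (f u * g v)  ≡⟨ sum-cong-≗ (λ u → *-distribˡ-sum (f u) g) ⟨
  ∑[ u < n ] (f u * ∑[ v < n ] g v)  ≡⟨ *-distribʳ-sum (∑[ v < n ] g v) f ⟨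
  ∑[ u < n ] f u * ∑[ v < n ] g v    ∎
  where open ≡-Reasoning

∑∑-distrib-+ : ∀ {n} (f g : Fin n → Fin n → ℕ) →
  ∑[ u < n ] ∑[ v < n ] (f u v + g u v) ≡ ∑[ u < n ] ∑[ v < n ] f u v + ∑[ u < n ] ∑[ v < n ] g u v
∑∑-distrib-+ {n} f g =
  trans (sum-cong-≗ λ u → ∑-distrib-+ (f u) (g u))
        (∑-distrib-+ (λ u → ∑[ v < n ] f u v) (λ u → ∑[ v < n ] g u v))

pairSum : ∀ {n} → (Fin n → Fin n → ℕ) → ℕ
pairSum {n} f = ∑[ u < n ] ∑[ v < n ] (if does (u <? v) then f u v else 0)

guard-+ : ∀ {p} {P : Set p} (P? : Dec P) (x y : ℕ) →
  (if does P? then x + y else 0) ≡ (if does P? then x else 0) + (if does P? then y else 0)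
guard-+ (yes _) x y = refl
guard-+ (no _)  x y = refl

pairSum-+ : ∀ {n} (f g : Fin n → Fin n → ℕ) →
  pairSum (λ u v → f u v + g u v) ≡ pairSum f + pairSum g
pairSum-+ f g = trans (sum-cong-≗ λ u → sum-cong-≗ λ v → guard-+ (u <? v) (f u v) (g u v))
                      (∑∑-distrib-+ (upper f) (upper g))
  where
  upper : (Fin _ → Fin _ → ℕ) → Fin _ → Fin _ → ℕ
  upper h u v = if does (u <? v) then h u v else 0

guard-mono-≤ : ∀ {p} {P : Set p} (P? : Dec P) {x y : ℕ} → (P → x ≤ y) →
  (if does P? then x else 0) ≤ (if does P? then y else 0)
guard-mono-≤ (yes p) x≤y = x≤y p
guard-mono-≤ (no _)  _   = z≤n

pairSum-mono-≤ : ∀ {n} {f g : Fin n → Fin n → ℕ} → (∀ {u v} → u Fin.< v → f u v ≤ g u v) →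
  pairSum f ≤ pairSum g
pairSum-mono-≤ f≤g = ∑-mono-≤ λ u → ∑-mono-≤ λ v → guard-mono-≤ (u <? v) f≤g

∑∑-symmetric : ∀ {n} (f : Fin n → Fin n → ℕ) → (∀ u v → f u v ≡ f v u) →
  ∑[ u < n ] ∑[ v < n ] f u v ≡ pairSum f + pairSum f + ∑[ u < n ] f u u
∑∑-symmetric {n} f f-sym = begin
  ∑[ u < n ] ∑[ v < n ] f u v
    ≡⟨ sum-cong-≗ (λ u → sum-cong-≗ (split u)) ⟩
  ∑[ u < n ] ∑[ v < n ] (upper u v + upper v u + diagonal u v)
    ≡⟨ sum-cong-≗ row ⟩
  ∑[ u < n ] (∑[ v < n ] upper u v + ∑[ v < n ] upper v u + f u u)
    ≡⟨ ∑-distrib-+ (λ u → ∑[ v < n ] upper u v + ∑[ v < n ] upper v u) (λ u → f u u) ⟩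
  ∑[ u < n ] (∑[ v < n ] upper u v + ∑[ v < n ] upper v u) + ∑[ u < n ] f u u
    ≡⟨ cong (_+ ∑[ u < n ] f u u) (∑-distrib-+ (λ u → ∑[ v < n ] upper u v) (λ u → ∑[ v < n ] upper v u)) ⟩
  pairSum f + ∑[ u < n ] ∑[ v < n ] upper v u + ∑[ u < n ] f u u
    ≡⟨ cong (λ s → pairSum f + s + ∑[ u < n ] f u u) (∑-comm (λ u v → upper v u)) ⟩
  pairSum f + pairSum f + ∑[ u < n ] f u u
    ∎
  where
  open ≡-Reasoning
  upper diagonal : Fin n → Fin n → ℕ
  upper u v = if does (u <? v) then f u v else 0
  diagonal u v = if does (u ≟ v) then f u u else 0
  row : ∀ u → ∑[ v < n ] (upper u v + upper v u + diagonal u v)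
            ≡ ∑[ v < n ] upper u v + ∑[ v < n ] upper v u + f u u
  row u = begin
    ∑[ v < n ] (upper u v + upper v u + diagonal u v)
      ≡⟨ ∑-distrib-+ (λ v → upper u v + upper v u) (diagonal u) ⟩
    ∑[ v < n ] (upper u v + upper v u) + ∑[ v < n ] diagonal u v
      ≡⟨ cong₂ _+_ (∑-distrib-+ (upper u) (λ v → upper v u)) (∑-δ u (f u u)) ⟩
    ∑[ v < n ] upper u v + ∑[ v < n ] upper v u + f u u
      ∎
  split : ∀ u v → f u v ≡ upper u v + upper v u + diagonal u v
  split u v with <-cmp u v
  ... | tri< u<v u≢v _
    rewrite dec-true (u <? v) u<v | dec-false (v <? u) (<-asym u<v) | dec-false (u ≟ v) u≢v
    = sym (trans (+-identityʳ _) (+-identityʳ _))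
  ... | tri≈ _ refl _
    rewrite dec-false (u <? u) (<-irrefl refl) | dec-true (u ≟ u) refl
    = refl
  ... | tri> _ u≢v v<u
    rewrite dec-false (u <? v) (<-asym v<u) | dec-true (v <? u) v<u | dec-false (u ≟ v) u≢v
    = trans (f-sym u v) (sym (+-identityʳ _))

sum-tabulate : ∀ {n} (f : Fin n → ℕ) → sum (tabulate f) ≡ ∑[ i < n ] f i
sum-tabulate {zero}  f = refl
sum-tabulate {suc n} f = cong (f zero +_) (sum-tabulate (f ∘ suc))

sum-map-allFin : ∀ {n} (f : Fin n → ℕ) → sum (map f (allFin n)) ≡ ∑[ i < n ] f i
sum-map-allFin {n} f = trans (cong sum (map-tabulate id f)) (sum-tabulate f)

module _ {a} {A : Set a} where

  sum-map-filter : ∀ {p} {P : Pred A p} (P? : Decidable P) (f : A → ℕ) (xs : List A) →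
    sum (map f (filter P? xs)) ≡ sum (map (λ x → if does (P? x) then f x else 0) xs)
  sum-map-filter P? f []       = refl
  sum-map-filter P? f (x ∷ xs) with does (P? x)
  ... | true  = cong (f x +_) (sum-map-filter P? f xs)
  ... | false = sum-map-filter P? f xs

  length-filter-true : (p : A → Bool) (xs : List A) →
    length (filter (λ x → p x Bool.≟ true) xs) ≡ sum (map (χ ∘ p) xs)
  length-filter-true p []       = refl
  length-filter-true p (x ∷ xs) with p x
  ... | true  = cong suc (length-filter-true p xs)
  ... | false = length-filter-true p xs

  sum-map-concatMap : ∀ {b} {B : Set b} (f : B → ℕ) (g : A → List B) (xs : List A) →
    sum (map f (concatMap g xs)) ≡ sum (map (λ x → sum (map f (g x))) xs)
  sum-map-concatMap f g []       = refl
  sum-map-concatMap f g (x ∷ xs) = begin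
    sum (map f (g x ++ concatMap g xs))
      ≡⟨ cong sum (map-++ f (g x) _) ⟩
    sum (map f (g x) ++ map f (concatMap g xs))
      ≡⟨ sum-++ (map f (g x)) _ ⟩
    sum (map f (g x)) + sum (map f (concatMap g xs))
      ≡⟨ cong (sum (map f (g x)) +_) (sum-map-concatMap f g xs) ⟩
    sum (map f (g x)) + sum (map (λ y → sum (map f (g y))) xs)
      ∎
    where open ≡-Reasoning

  any-true : (p : A → Bool) {x : A} {xs : List A} → x ∈ xs → p x ≡ true → any p xs ≡ true
  any-true p {xs = _ ∷ ys} (here refl) px = cong (_∨ any p ys) px
  any-true p {xs = y ∷ _} (there x∈xs) px = trans (cong (p y ∨_) (any-true p x∈xs px)) (∨-zeroʳ (p y))

  any-false : (p : A → Bool) (xs : List A) → (∀ x → p x ≡ false) → any p xs ≡ false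
  any-false p []       _  = refl
  any-false p (x ∷ xs) ¬p = cong₂ _∨_ (¬p x) (any-false p xs ¬p)

  ≤-foldr-⊔ : (f : A → ℕ) {x : A} {xs : List A} → x ∈ xs → f x ≤ foldr (λ y m → f y ⊔ m) 0 xs
  ≤-foldr-⊔ f (here refl)          = m≤m⊔n _ _
  ≤-foldr-⊔ f {xs = y ∷ _} (there x∈xs) = ≤-trans (≤-foldr-⊔ f x∈xs) (m≤n⊔m (f y) _)

  foldr-⊔-lub : (f : A → ℕ) (xs : List A) {c : ℕ} → (∀ x → f x ≤ c) →
    foldr (λ y m → f y ⊔ m) 0 xs ≤ c
  foldr-⊔-lub f []       _   = z≤n
  foldr-⊔-lub f (x ∷ xs) f≤c = ⊔-lub (f≤c x) (foldr-⊔-lub f xs f≤c)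

differ : Bool → Bool → ℕ
differ a b = χ a * χ (not b) + χ (not a) * χ b

bothFalse : Bool → Bool → ℕ
bothFalse a b = χ (not a) * χ (not b)

differ-sym : ∀ a b → differ a b ≡ differ b a
differ-sym true  true  = refl
differ-sym true  false = refl
differ-sym false true  = refl
differ-sym false false = refl

bothFalse-sym : ∀ a b → bothFalse a b ≡ bothFalse b a
bothFalse-sym true  true  = refl
bothFalse-sym true  false = refl
bothFalse-sym false true  = refl
bothFalse-sym false false = refl

differ-refl : ∀ a → differ a a ≡ 0
differ-refl true  = refl
differ-refl false = refl

bothFalse-refl : ∀ a → bothFalse a a ≡ χ (not a)
bothFalse-refl true  = refl
bothFalse-refl false = refl

χ+χ-not : ∀ a → χ a + χ (not a) ≡ 1
χ+χ-not true  = refl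
χ+χ-not false = refl

module Colouring {n : ℕ} (c : Fin n → Bool) where

  #true #false : ℕ
  #true  = ∑[ u < n ] χ (c u)
  #false = ∑[ u < n ] χ (not (c u))

  #mixedPairs #falsePairs : ℕ
  #mixedPairs = pairSum (λ u v → differ (c u) (c v))
  #falsePairs = pairSum (λ u v → bothFalse (c u) (c v))

  #true+#false : #true + #false ≡ n
  #true+#false = trans (sym (∑-distrib-+ (χ ∘ c) (χ ∘ not ∘ c)))
                       (trans (sum-cong-≗ (χ+χ-not ∘ c)) (∑-const-1 n))

  #mixedPairs-double : #mixedPairs + #mixedPairs ≡ #true * #false + #false * #true
  #mixedPairs-double = begin
    P + P
      ≡⟨ +-identityʳ (P + P) ⟨
    P + P + 0
      ≡⟨ cong (P + P +_) (trans (sum-cong-≗ (differ-refl ∘ c)) (sum-replicate-zero n)) ⟨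
    P + P + ∑[ u < n ] differ (c u) (c u)
      ≡⟨ ∑∑-symmetric (λ u v → differ (c u) (c v)) (λ u v → differ-sym (c u) (c v)) ⟨
    ∑[ u < n ] ∑[ v < n ] differ (c u) (c v)
      ≡⟨ ∑∑-distrib-+ (λ u v → χ (c u) * χ (not (c v))) (λ u v → χ (not (c u)) * χ (c v)) ⟩
    ∑[ u < n ] ∑[ v < n ] (χ (c u) * χ (not (c v))) + ∑[ u < n ] ∑[ v < n ] (χ (not (c u)) * χ (c v))
      ≡⟨ cong₂ _+_ (∑∑-product (χ ∘ c) (χ ∘ not ∘ c))
                   (∑∑-product (χ ∘ not ∘ c) (χ ∘ c)) ⟩
    #true * #false + #false * #true
      ∎
    where
    open ≡-Reasoning
    P = #mixedPairs

  #falsePairs-double : #falsePairs + #falsePairs + #false ≡ #false * #false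
  #falsePairs-double = begin
    P + P + #false
      ≡⟨ cong (P + P +_) (sum-cong-≗ (bothFalse-refl ∘ c)) ⟨
    P + P + ∑[ u < n ] bothFalse (c u) (c u)
      ≡⟨ ∑∑-symmetric (λ u v → bothFalse (c u) (c v)) (λ u v → bothFalse-sym (c u) (c v)) ⟨
    ∑[ u < n ] ∑[ v < n ] bothFalse (c u) (c v)
      ≡⟨ ∑∑-product (χ ∘ not ∘ c) (χ ∘ not ∘ c) ⟩
    #false * #false
      ∎
    where
    open ≡-Reasoning
    P = #falsePairs

module _ {p} {P : Set p} (P? : Dec P) where

  ⌊⌋≡true : P → ⌊ P? ⌋ ≡ true
  ⌊⌋≡true p = trans (isYes≗does P?) (dec-true P? p)

  ⌊⌋≡false : ¬ P → ⌊ P? ⌋ ≡ false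
  ⌊⌋≡false ¬p = trans (isYes≗does P?) (dec-false P? ¬p)

⌊⌋≡true⇒ : ∀ {p} {P : Set p} (P? : Dec P) → ⌊ P? ⌋ ≡ true → P
⌊⌋≡true⇒ (yes p) _ = p

-- dist is a search with fuel n + 1, so it only unfolds to k = 1 (resp. k = 2) once n is a successor.
dist≡1 : ∀ {n} (G : Graph n) {u v} → reach G 0 u v ≡ false → reach G 1 u v ≡ true → dist G u v ≡ 1
dist≡1 {suc n} G r₀ r₁ rewrite r₀ | r₁ = refl

dist≡2 : ∀ {n} (G : Graph n) {u v} →
  reach G 0 u v ≡ false → reach G 1 u v ≡ false → reach G 2 u v ≡ true → dist G u v ≡ 2
dist≡2 {suc (suc n)} G r₀ r₁ r₂ rewrite r₀ | r₁ | r₂ = refl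
dist≡2 {suc zero} G {zero} {zero} () _ _

edge-bound : ∀ a b {x y} → (if a then 1 else 2) ≤ x → (if b then 1 else 2) ≤ y →
  1 + differ a b ≤ x * y + (bothFalse a b + bothFalse a b)
edge-bound true  true  x≥1 y≥1 = ≤-trans (*-mono-≤ x≥1 y≥1) (m≤m+n _ 0)
edge-bound true  false x≥1 y≥2 = ≤-trans (*-mono-≤ x≥1 y≥2) (m≤m+n _ 0)
edge-bound false true  x≥2 y≥1 = ≤-trans (*-mono-≤ x≥2 y≥1) (m≤m+n _ 0)
edge-bound false false _   _   = ≤-trans (s≤s z≤n) (m≤n+m 2 _)

module _ {n : ℕ} (G : Graph n) where

  dist-refl : ∀ u → dist G u u ≡ 0
  dist-refl u rewrite ⌊⌋≡true (u ≟ u) refl = refl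

  adj⇒reach₁ : ∀ {u v} → adj G u v ≡ true → reach G 1 u v ≡ true
  adj⇒reach₁ {u} {v} uv =
    trans (cong (reach G 0 u v ∨_) (any-true _ (∈-allFin u) first-step)) (∨-zeroʳ _)
    where
    first-step : reach G 0 u u ∧ adj G u v ≡ true
    first-step = trans (cong (_∧ adj G u v) (⌊⌋≡true (u ≟ u) refl)) uv

  ¬adj⇒¬reach₁ : ∀ {u v} → u ≢ v → adj G u v ≡ false → reach G 1 u v ≡ false
  ¬adj⇒¬reach₁ {u} {v} u≢v ¬uv =
    cong₂ _∨_ (⌊⌋≡false (u ≟ v) u≢v) (any-false _ (allFin n) no-first-step)
    where
    no-first-step : ∀ w → reach G 0 u w ∧ adj G w v ≡ false
    no-first-step w with u ≟ w
    ... | yes refl = ¬uv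
    ... | no  _    = refl

  reach₂ : ∀ {u v} w → adj G u w ≡ true → adj G w v ≡ true → reach G 2 u v ≡ true
  reach₂ {u} {v} w uw wv =
    trans (cong (reach G 1 u v ∨_) (any-true _ (∈-allFin w) (cong₂ _∧_ (adj⇒reach₁ uw) wv))) (∨-zeroʳ _)

  dist-adj : ∀ {u v} → u ≢ v → adj G u v ≡ true → dist G u v ≡ 1
  dist-adj {u} {v} u≢v uv = dist≡1 G (⌊⌋≡false (u ≟ v) u≢v) (adj⇒reach₁ uv)

  dist-common-neighbour : ∀ {u v} w → u ≢ v → adj G u v ≡ false →
    adj G u w ≡ true → adj G w v ≡ true → dist G u v ≡ 2
  dist-common-neighbour {u} {v} w u≢v ¬uv uw wv =
    dist≡2 G (⌊⌋≡false (u ≟ v) u≢v) (¬adj⇒¬reach₁ u≢v ¬uv) (reach₂ w uw wv)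

  dist≤ecc : ∀ u v → dist G u v ≤ ecc G u
  dist≤ecc u v = ≤-foldr-⊔ (dist G u) (∈-allFin v)

  diameter≤ : ∀ {c} → (∀ u v → dist G u v ≤ c) → diameter G ≤ c
  diameter≤ d≤c = foldr-⊔-lub (ecc G) (allFin n) (λ u → foldr-⊔-lub (dist G u) (allFin n) (d≤c u))

  degree≡∑ : ∀ u → degree G u ≡ ∑[ w < n ] χ (adj G u w)
  degree≡∑ u = trans (length-filter-true (adj G u) (allFin n)) (sum-map-allFin (χ ∘ adj G u))

  inClosedNbhd : Fin n → Fin n → ℕ
  inClosedNbhd u w = χ (adj G u w) + (if does (u ≟ w) then 1 else 0)

  ∑-inClosedNbhd : ∀ u → ∑[ w < n ] inClosedNbhd u w ≡ degree G u + 1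
  ∑-inClosedNbhd u =
    trans (∑-distrib-+ (χ ∘ adj G u) (λ w → if does (u ≟ w) then 1 else 0))
          (cong₂ _+_ (sym (degree≡∑ u)) (∑-δ u 1))

  inClosedNbhd≤1 : ∀ u w → inClosedNbhd u w ≤ 1
  inClosedNbhd≤1 u w with u ≟ w
  ... | yes refl rewrite irrefl G u = ≤-refl
  ... | no _ with adj G u w
  ...   | true  = ≤-refl
  ...   | false = z≤n

  universal⇒adj : ∀ {u v} → isUniversal G u ≡ true → u ≢ v → adj G u v ≡ true
  universal⇒adj {u} {v} univ u≢v
    with u ≟ v | adj G u v | ∑≡n⇒all-1 (inClosedNbhd u) (inClosedNbhd≤1 u) ∑≡n v
    where
    ∑≡n : ∑[ w < n ] inClosedNbhd u w ≡ n
    ∑≡n = trans (∑-inClosedNbhd u)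
                (trans (cong (_+ 1) (⌊⌋≡true⇒ (degree G u ℕ.≟ n ∸ 1) univ))
                       (m∸n+n≡m (≤-trans (s≤s z≤n) (toℕ<n u))))
  ... | yes u≡v | _     | _  = contradiction u≡v u≢v
  ... | no _    | true  | _  = refl
  ... | no _    | false | ()

  adj⇒universal : ∀ {u} → (∀ v → u ≢ v → adj G u v ≡ true) → isUniversal G u ≡ true
  adj⇒universal {u} u∼all = ⌊⌋≡true (degree G u ℕ.≟ n ∸ 1) (begin
    degree G u                         ≡⟨ m+n∸n≡m (degree G u) 1 ⟨
    degree G u + 1 ∸ 1                 ≡⟨ cong (_∸ 1) (∑-inClosedNbhd u) ⟨
    ∑[ w < n ] inClosedNbhd u w ∸ 1    ≡⟨ cong (_∸ 1) (trans (sum-cong-≗ all-1) (∑-const-1 n)) ⟩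
    n ∸ 1                              ∎)
    where
    open ≡-Reasoning
    all-1 : ∀ w → inClosedNbhd u w ≡ 1
    all-1 w with u ≟ w
    ... | yes refl rewrite irrefl G u = refl
    ... | no u≢w   rewrite u∼all w u≢w = refl

  nonuniversal⇒non-neighbour : ∀ {u} → isUniversal G u ≡ false → ∃ λ v → u ≢ v × adj G u v ≡ false
  nonuniversal⇒non-neighbour {u} nonuniv
    with v , ¬u∼v ← ¬∀⟶∃¬ n (λ v → u ≢ v → adj G u v ≡ true)
                             (λ v → ¬? (u ≟ v) →-dec adj G u v Bool.≟ true)
                             (λ u∼all → contradiction (trans (sym nonuniv) (adj⇒universal u∼all)) λ ())
    = v , (λ u≡v → ¬u∼v λ u≢v → contradiction u≡v u≢v) , ¬-not (λ u∼v → ¬u∼v λ _ → u∼v)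

  sum-pairs : (h : Fin n × Fin n → ℕ) → sum (map h (pairs G)) ≡ pairSum (λ u v → h (u , v))
  sum-pairs h = begin
    sum (map h (pairs G))
      ≡⟨ sum-map-concatMap h row (allFin n) ⟩
    sum (map (λ u → sum (map h (row u))) (allFin n))
      ≡⟨ sum-map-allFin (λ u → sum (map h (row u))) ⟩
    ∑[ u < n ] sum (map h (row u))
      ≡⟨ sum-cong-≗ (λ u → cong sum (map-∘ {g = h} {f = u ,_} (filter (u <?_) (allFin n)))) ⟨
    ∑[ u < n ] sum (map (λ v → h (u , v)) (filter (u <?_) (allFin n)))
      ≡⟨ sum-cong-≗ (λ u → trans (sum-map-filter (u <?_) (λ v → h (u , v)) (allFin n))
                                 (sum-map-allFin (λ v → if does (u <? v) then h (u , v) else 0))) ⟩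
    pairSum (λ u v → h (u , v))
      ∎
    where
    open ≡-Reasoning
    row : Fin n → List (Fin n × Fin n)
    row u = map (u ,_) (filter (u <?_) (allFin n))

  adj⇒≢ : ∀ {u v} → adj G u v ≡ true → u ≢ v
  adj⇒≢ {u} uv refl = contradiction (trans (sym (irrefl G u)) uv) λ ()

  nonadj⇒nonuniversal : ∀ {u v} → u ≢ v → adj G u v ≡ false → isUniversal G u ≡ false
  nonadj⇒nonuniversal u≢v ¬uv =
    ¬-not (λ univ → contradiction (trans (sym ¬uv) (universal⇒adj univ u≢v)) λ ())

  module _ {w} (w-univ : isUniversal G w ≡ true) where

    open Colouring (isUniversal G)

    nonadj⇒dist≡2 : ∀ {u v} → u ≢ v → adj G u v ≡ false → dist G u v ≡ 2
    nonadj⇒dist≡2 {u} {v} u≢v ¬uv =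
      dist-common-neighbour w u≢v ¬uv
        (trans (Graph.sym G u w) (universal⇒adj w-univ w≢u)) (universal⇒adj w-univ w≢v)
      where
      w≢u : w ≢ u
      w≢u refl = contradiction (trans (sym w-univ) (nonadj⇒nonuniversal u≢v ¬uv)) λ ()
      w≢v : w ≢ v
      w≢v refl =
        contradiction (trans (sym w-univ) (nonadj⇒nonuniversal (u≢v ∘ sym) (trans (Graph.sym G v u) ¬uv))) λ ()

    ecc-bound : ∀ {u v} → adj G u v ≡ true → (if isUniversal G u then 1 else 2) ≤ ecc G u
    ecc-bound {u} {v} uv with isUniversal G u in u-univ
    ... | true = subst (_≤ ecc G u) (dist-adj (adj⇒≢ uv) uv) (dist≤ecc u v)
    ... | false with v′ , u≢v′ , ¬uv′ ← nonuniversal⇒non-neighbour u-univ =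
      subst (_≤ ecc G u) (nonadj⇒dist≡2 u≢v′ ¬uv′) (dist≤ecc u v′)

    pair-bound : ∀ {u v} → u ≢ v →
      dist G u v + differ (isUniversal G u) (isUniversal G v)
        ≤ (if adj G u v then ecc G u * ecc G v else 0)
          + (bothFalse (isUniversal G u) (isUniversal G v) + bothFalse (isUniversal G u) (isUniversal G v))
    pair-bound {u} {v} u≢v with adj G u v in uv
    ... | true rewrite dist-adj u≢v uv =
      edge-bound (isUniversal G u) (isUniversal G v) (ecc-bound uv) (ecc-bound (trans (Graph.sym G v u) uv))
    ... | false
      rewrite nonadj⇒dist≡2 u≢v uv
            | nonadj⇒nonuniversal u≢v uv
            | nonadj⇒nonuniversal (u≢v ∘ sym) (trans (Graph.sym G v u) uv) = ≤-refl

    pairSum-bound : wiener G + #mixedPairs ≤ E2 G + (#falsePairs + #falsePairs)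
    pairSum-bound = begin
      wiener G + pairSum differ′
        ≡⟨ cong (_+ pairSum differ′) (sum-pairs (λ p → dist G (proj₁ p) (proj₂ p))) ⟩
      pairSum (dist G) + pairSum differ′
        ≡⟨ pairSum-+ (dist G) differ′ ⟨
      pairSum (λ u v → dist G u v + differ′ u v)
        ≤⟨ pairSum-mono-≤ (pair-bound ∘ <⇒≢) ⟩
      pairSum (λ u v → edge u v + (bothFalse′ u v + bothFalse′ u v))
        ≡⟨ pairSum-+ edge (λ u v → bothFalse′ u v + bothFalse′ u v) ⟩
      pairSum edge + pairSum (λ u v → bothFalse′ u v + bothFalse′ u v)
        ≡⟨ cong₂ _+_ (sym (sum-pairs (λ p → edge (proj₁ p) (proj₂ p))))
                     (pairSum-+ bothFalse′ bothFalse′) ⟩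
      E2 G + (pairSum bothFalse′ + pairSum bothFalse′)
        ∎
      where
      open ≤-Reasoning
      differ′ bothFalse′ edge : Fin n → Fin n → ℕ
      differ′ u v = differ (isUniversal G u) (isUniversal G v)
      bothFalse′ u v = bothFalse (isUniversal G u) (isUniversal G v)
      edge u v = if adj G u v then ecc G u * ecc G v else 0

  all-universal⇒diameter≤1 : (∀ u → isUniversal G u ≡ true) → diameter G ≤ 1
  all-universal⇒diameter≤1 all-univ = diameter≤ λ u v → dist≤1 (u ≟ v)
    where
    dist≤1 : ∀ {u v} → Dec (u ≡ v) → dist G u v ≤ 1
    dist≤1 {u} (yes refl) = subst (_≤ 1) (sym (dist-refl u)) z≤n
    dist≤1 {u} (no u≢v)   = ≤-reflexive (dist-adj u≢v (universal⇒adj (all-univ u) u≢v))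

  diameter≡2⇒nonuniversal : diameter G ≡ 2 → ∃ λ u → isUniversal G u ≡ false
  diameter≡2⇒nonuniversal diam
    with u , ¬univ ← ¬∀⟶∃¬ n (λ u → isUniversal G u ≡ true) (λ u → isUniversal G u Bool.≟ true)
                       (λ all-univ → contradiction (subst (_≤ 1) diam (all-universal⇒diameter≤1 all-univ))
                                                   λ { (s≤s ()) })
    = u , ¬-not ¬univ

  numUniversal≡#true : numUniversal G ≡ Colouring.#true (isUniversal G)
  numUniversal≡#true =
    trans (length-filter-true (isUniversal G) (allFin n)) (sum-map-allFin (χ ∘ isUniversal G))

halve-≤ : ∀ {x y} → x + x ≤ y + y → x ≤ y
halve-≤ x+x≤y+y = ≮⇒≥ λ y<x → <⇒≱ (+-mono-< y<x y<x) x+x≤y+y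

pair-counts⇒< : ∀ {W E m b k r} → W + m ≤ E + (b + b) → m + m ≡ k * r + r * k → b + b + r ≡ r * r →
  r ≤ k → 0 < r → W < E
pair-counts⇒< {W} {E} {m} {b} {k} {r} bound 2m≡ 2b+r≡ r≤k r>0 =
  <-≤-trans (m<m+n W r>0) (+-cancelʳ-≤ (b + b) (W + r) E (begin
    W + r + (b + b)   ≡⟨ +-assoc W r (b + b) ⟩
    W + (r + (b + b)) ≡⟨ cong (W +_) (+-comm r (b + b)) ⟩
    W + (b + b + r)   ≤⟨ +-monoʳ-≤ W b+b+r≤m ⟩
    W + m             ≤⟨ bound ⟩
    E + (b + b)       ∎))
  where
  open ≤-Reasoning
  b+b+r≤m : b + b + r ≤ m
  b+b+r≤m = halve-≤ (begin
    (b + b + r) + (b + b + r)  ≡⟨ cong₂ _+_ 2b+r≡ 2b+r≡ ⟩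
    r * r + r * r              ≤⟨ +-mono-≤ (*-monoˡ-≤ r r≤k) (*-monoʳ-≤ r r≤k) ⟩
    k * r + r * k              ≡⟨ 2m≡ ⟨
    m + m                      ∎)

minority≤majority : ∀ k r → k + r ∸ 1 < 2 * k → r ≤ k
minority≤majority k r lt = +-cancelˡ-≤ k r k (begin
  k + r                ≤⟨ m≤n+m∸n (k + r) 1 ⟩
  1 + (k + r ∸ 1)      ≤⟨ lt ⟩
  2 * k                ≡⟨ cong (k +_) (+-identityʳ k) ⟩
  k + k                ∎)
  where open ≤-Reasoning

0<χ⇒true : ∀ {b} → 0 < χ b → b ≡ true
0<χ⇒true {true} _ = refl

theorem2p7 : (n : ℕ) → 3 ≤ n → (G : Graph n) → diameter G ≡ 2 →
    n ∸ 1 < 2 * numUniversal G → wiener G < E2 G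
theorem2p7 n _ G diam majority =
  pair-counts⇒< {b = #falsePairs}
    (pairSum-bound G (proj₂ universal-vertex)) #mixedPairs-double #falsePairs-double r≤k 0<r
  where
  open Colouring (isUniversal G)
  r≤k : #false ≤ #true
  r≤k = minority≤majority #true #false
          (subst₂ (λ m k → m ∸ 1 < 2 * k) (sym #true+#false) (numUniversal≡#true G) majority)
  0<r : 0 < #false
  0<r = let v , v-nonuniv = diameter≡2⇒nonuniversal G diam in
        ≤-trans (subst (λ b → 0 < χ (not b)) (sym v-nonuniv) ≤-refl) (term≤∑ (χ ∘ not ∘ isUniversal G) v)
  universal-vertex : ∃ λ w → isUniversal G w ≡ true
  universal-vertex = map₂ 0<χ⇒true (∑-pos⇒∃ (χ ∘ isUniversal G) (<-≤-trans 0<r r≤k))
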